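{- Let $B_{11}$ and $B_{12}$ be the graphs on vertex set $\{1,\dots,18\}$ with edge sets $B_{11}$: $\{2,4\},\{3,4\},\{1,2\},\{1,5\},\{3,5\},\{6,8\},\{16,18\},\{16,17\},\{6,7\},\{2,7\},\{1,8\},\{4,9\},\{5,10\},\{11,15\},\{14,15\},\{12,14\},\{12,13\},\{11,13\},\{14,17\},\{13,16\},\{15,18\},\{8,9\},\{7,10\},\{9,11\},\{6,12\},\{3,18\},\{10,17\}$; $B_{12}$: $\{2,4\},\{3,4\},\{1,2\},\{1,5\},\{3,5\},\{3,6\},\{6,8\},\{8,18\},\{16,18\},\{16,17\},\{7,17\},\{6,7\},\{2,7\},\{1,8\},\{4,9\},\{9,12\},\{5,10\},\{10,11\},\{11,15\},\{14,15\},\{12,14\},\{12,13\},\{11,13\},\{14,17\},\{13,16\},\{15,18\},\{9,10\}$. For each $G \in \{B_{11},B_{12}\}$ there exist $G$ designs of order $28$, $55$ and $109$.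
   Context: All graphs are simple. For a graph $G$, a $G$ design of order $n$ is a partition of the edge set of the complete graph $K_n$ into edge sets of subgraphs each isomorphic to $G$. $B_{11}$ and $B_{12}$ are the two 18-vertex Blanuša snarks. -}

module Defs where

open import Data.Nat using (ℕ; suc; _<_; _∸_)
open import Data.Nat.Properties using (≤-trans; m∸n≤m)
open import Data.Fin using (Fin; _≟_; #_)
import Data.Nat
open import Data.Product using (Σ; _×_; _,_)
open import Data.Sum using (_⊎_)
open import Data.List using (List; []; _∷_; map; concatMap; filter; length)
open import Data.List.Relation.Unary.All using (All)
open import Relation.Binary.PropositionalEquality using (_≡_; _≢_)
open import Relation.Nullary using (Dec)
open import Relation.Nullary.Decidable using (_×-dec_; _⊎-dec_; True; toWitness)
open import Function.Definitions using (Injective)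

-- A finite simple graph on vertex set Fin order, given by its edge list
-- (each unordered edge listed once, as an ordered pair of distinct vertices).
record Graph : Set where
  field
    order : ℕ
    edges : List (Fin order × Fin order)
open Graph public

SameEdge : {n : ℕ} → (Fin n × Fin n) → (Fin n × Fin n) → Set
SameEdge (a , b) (c , d) = (a ≡ c × b ≡ d) ⊎ (a ≡ d × b ≡ c)

sameEdge? : {n : ℕ} → (p q : Fin n × Fin n) → Dec (SameEdge p q)
sameEdge? (a , b) (c , d) = ((a ≟ c) ×-dec (b ≟ d)) ⊎-dec ((a ≟ d) ×-dec (b ≟ c))

imageEdges : (G : Graph) {n : ℕ} → (Fin (order G) → Fin n) → List (Fin n × Fin n)
imageEdges G f = map (λ { (u , v) → (f u , f v) }) (edges G)

-- A G design of order n: a list of copies of G in K_n (each copy given by an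
-- injective vertex map Fin (order G) → Fin n) such that every edge {x , y} of K_n
-- (x ≢ y) lies in exactly one copy, i.e. the edge sets of the copies partition E(K_n).
IsDesign : (G : Graph) (n : ℕ) → List (Fin (order G) → Fin n) → Set
IsDesign G n blocks =
  All (λ f → Injective _≡_ _≡_ f) blocks
  × ((x y : Fin n) → x ≢ y →
       length (filter (sameEdge? (x , y)) (concatMap (imageEdges G) blocks)) ≡ 1)

HasDesign : Graph → ℕ → Set
HasDesign G n = Σ (List (Fin (order G) → Fin n)) (IsDesign G n)

-- Vertex k of the paper (k ∈ {1,…,18}) is the Fin 18 element k ∸ 1.
e : (a b : ℕ) {a< : True ((a ∸ 1) Data.Nat.<? 18)} {b< : True ((b ∸ 1) Data.Nat.<? 18)} → Fin 18 × Fin 18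
e a b {a<} {b<} = (#_ (a ∸ 1) {18} {a<} , #_ (b ∸ 1) {18} {b<})

B11 : Graph
B11 = record { order = 18 ; edges =
    e 2 4
    ∷ e 3 4
    ∷ e 1 2
    ∷ e 1 5
    ∷ e 3 5
    ∷ e 6 8
    ∷ e 16 18
    ∷ e 16 17
    ∷ e 6 7
    ∷ e 2 7
    ∷ e 1 8
    ∷ e 4 9
    ∷ e 5 10
    ∷ e 11 15
    ∷ e 14 15
    ∷ e 12 14
    ∷ e 12 13
    ∷ e 11 13
    ∷ e 14 17
    ∷ e 13 16
    ∷ e 15 18
    ∷ e 8 9
    ∷ e 7 10
    ∷ e 9 11
    ∷ e 6 12
    ∷ e 3 18
    ∷ e 10 17
    ∷ [] }

B12 : Graph
B12 = record { order = 18 ; edges =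
    e 2 4
    ∷ e 3 4
    ∷ e 1 2
    ∷ e 1 5
    ∷ e 3 5
    ∷ e 3 6
    ∷ e 6 8
    ∷ e 8 18
    ∷ e 16 18
    ∷ e 16 17
    ∷ e 7 17
    ∷ e 6 7
    ∷ e 2 7
    ∷ e 1 8
    ∷ e 4 9
    ∷ e 9 12
    ∷ e 5 10
    ∷ e 10 11
    ∷ e 11 15
    ∷ e 14 15
    ∷ e 12 14
    ∷ e 12 13
    ∷ e 11 13
    ∷ e 14 17
    ∷ e 13 16
    ∷ e 15 18
    ∷ e 9 10
    ∷ [] }

module Submission where

-- Every design is built by the difference method: its copies of G are the translates of one
-- or two base blocks (injective labellings of V(G) by residues) under a cyclic group of
-- translations of ℤ_n. That these copies partition E(K_n) is verified by computation: coding
-- the edge {x , y}, x < y, of K_n as n x + y, the sorted list of the codes of all copy edges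
-- must be the list of codes of all edges of K_n, in which every code occurs once.

open import Defs
open import Data.Nat using (ℕ; suc; _+_; _*_; _%_; _≤_; z≤n; s≤s; NonZero)
import Data.Nat.Properties as ℕ
open import Data.Nat.Properties using (*-comm; +-assoc; _≟_; ≤-decTotalOrder; ≰⇒>; <⇒≤)
open import Data.Nat.DivMod using (_mod_; [m+kn]%n≡m%n; %-distribˡ-+)
open import Data.Product using (_×_; _,_; uncurry)
open import Data.Sum using (_⊎_; inj₁; inj₂)
open import Data.Fin using (Fin; toℕ; combine; _<_)
open import Data.Fin.Properties
  using (toℕ-injective; toℕ-fromℕ<; toℕ-combine; combine-injective; _≤?_; _<?_;
         ≤-antisym; ≤∧≢⇒<; all?) renaming (_≟_ to _≟ᶠ_)
open import Data.List using (List; []; _∷_; map; concatMap; filter; length; cartesianProduct; allFin; upTo)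
open import Data.List.Properties using (filter-some; ≡-dec)
open import Data.List.Relation.Unary.All as All using (All; []; _∷_)
open import Data.List.Relation.Unary.All.Properties using (all-filter; concat⁺; map⁺)
import Data.List.Relation.Unary.Unique.Propositional.Properties as Unique
open import Data.List.Relation.Unary.Unique.Propositional using (Unique; []; _∷_)
open import Data.List.Relation.Unary.AllPairs using (_∷_)
open import Data.List.Membership.Propositional using (_∈_)
open import Data.List.Membership.Propositional.Properties
  using (∈-map⁺; ∈-filter⁺; ∈-cartesianProduct⁺; ∈-allFin)
open import Data.List.Relation.Binary.Permutation.Propositional using (↭-sym)
open import Data.List.Relation.Binary.Permutation.Propositional.Properties using (↭-length; filter-↭)
open import Data.List.Sort.MergeSort.Base ≤-decTotalOrder using (sort)
open import Data.List.Sort.MergeSort.Properties ≤-decTotalOrder using (sort-↭)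
open import Data.Vec using (Vec; []; _∷_; lookup)
open import Data.Unit using (tt)
open import Data.Empty using (⊥-elim)
open import Function using (_∘_)
open import Function.Definitions using (Injective)
open import Relation.Binary.Definitions using (DecidableEquality)
open import Relation.Binary.PropositionalEquality
  using (_≡_; _≢_; refl; sym; trans; cong; subst; module ≡-Reasoning)
open import Relation.Nullary using (Dec; yes; no)
open import Relation.Nullary.Decidable using (True; toWitness; map′; _→-dec_)
open import Relation.Unary using (Pred; Decidable; _≐_)

module _ {A B : Set} {p q} {P : Pred A p} {Q : Pred B q} (P? : Decidable P) (Q? : Decidable Q) where

  length-filter-map : (f : A → B) → P ≐ Q ∘ f → ∀ xs →
                      length (filter P? xs) ≡ length (filter Q? (map f xs))
  length-filter-map f P≐Qf [] = refl
  length-filter-map f P≐Qf@(P⇒Qf , Qf⇒P) (x ∷ xs) with P? x | Q? (f x)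
  ... | yes _  | yes _   = cong suc (length-filter-map f P≐Qf xs)
  ... | no _   | no _    = length-filter-map f P≐Qf xs
  ... | yes Px | no ¬Qfx = ⊥-elim (¬Qfx (P⇒Qf Px))
  ... | no ¬Px | yes Qfx = ⊥-elim (¬Px (Qf⇒P Qfx))

unique∧all≡⇒length≤1 : ∀ {A : Set} {x : A} {ys} → Unique ys → All (x ≡_) ys → length ys ≤ 1
unique∧all≡⇒length≤1 []              []                = z≤n
unique∧all≡⇒length≤1 (_ ∷ [])        (_ ∷ [])          = s≤s z≤n
unique∧all≡⇒length≤1 ((y≢z ∷ _) ∷ _) (refl ∷ refl ∷ _) = ⊥-elim (y≢z refl)

unique∧∈⇒length-filter-≟≡1 : ∀ {x xs} → Unique xs → x ∈ xs → length (filter (x ≟_) xs) ≡ 1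
unique∧∈⇒length-filter-≟≡1 {x} {xs} xs! x∈xs = ℕ.≤-antisym
  (unique∧all≡⇒length≤1 (Unique.filter⁺ (x ≟_) xs!) (all-filter (x ≟_) xs))
  (filter-some (x ≟_) x∈xs)

module _ {n : ℕ} where

  SameEdge-sym : {p q : Fin n × Fin n} → SameEdge p q → SameEdge q p
  SameEdge-sym (inj₁ (refl , refl)) = inj₁ (refl , refl)
  SameEdge-sym (inj₂ (refl , refl)) = inj₂ (refl , refl)

  SameEdge-trans : {p q r : Fin n × Fin n} → SameEdge p q → SameEdge q r → SameEdge p r
  SameEdge-trans (inj₁ (refl , refl)) q~r                  = q~r
  SameEdge-trans (inj₂ (refl , refl)) (inj₁ (refl , refl)) = inj₂ (refl , refl)
  SameEdge-trans (inj₂ (refl , refl)) (inj₂ (refl , refl)) = inj₁ (refl , refl)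

  orient : Fin n × Fin n → Fin n × Fin n
  orient (x , y) with x ≤? y
  ... | yes _ = x , y
  ... | no _  = y , x

  orient-comm : ∀ x y → orient (x , y) ≡ orient (y , x)
  orient-comm x y with x ≤? y | y ≤? x
  ... | yes x≤y | yes y≤x rewrite ≤-antisym x≤y y≤x = refl
  ... | yes _   | no _    = refl
  ... | no _    | yes _   = refl
  ... | no x≰y  | no y≰x  = ⊥-elim (x≰y (<⇒≤ (≰⇒> y≰x)))

  SameEdge-orient : ∀ p → SameEdge (orient p) p
  SameEdge-orient (x , y) with x ≤? y
  ... | yes _ = inj₁ (refl , refl)
  ... | no _  = inj₂ (refl , refl)

  orient-< : ∀ {x y} → x ≢ y → uncurry _<_ (orient (x , y))
  orient-< {x} {y} x≢y with x ≤? y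
  ... | yes x≤y = ≤∧≢⇒< x≤y x≢y
  ... | no x≰y  = ≰⇒> x≰y

  pairCode : Fin n × Fin n → ℕ
  pairCode (x , y) = n * toℕ x + toℕ y

  pairCode-injective : Injective _≡_ _≡_ pairCode
  pairCode-injective {x , y} {u , v} eq
    with refl , refl ← combine-injective x y u v
           (toℕ-injective (trans (toℕ-combine x y) (trans eq (sym (toℕ-combine u v)))))
    = refl

  edgeCode : Fin n × Fin n → ℕ
  edgeCode = pairCode ∘ orient

  SameEdge⇒edgeCode≡ : ∀ {p q} → SameEdge p q → edgeCode p ≡ edgeCode q
  SameEdge⇒edgeCode≡ (inj₁ (refl , refl))           = refl
  SameEdge⇒edgeCode≡ {x , y} (inj₂ (refl , refl)) = cong pairCode (orient-comm x y)

  edgeCode≡⇒SameEdge : ∀ {p q} → edgeCode p ≡ edgeCode q → SameEdge p q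
  edgeCode≡⇒SameEdge {p} {q} eq = SameEdge-trans (SameEdge-sym (SameEdge-orient p))
    (subst (λ r → SameEdge r q) (sym (pairCode-injective eq)) (SameEdge-orient q))

  edgeCodes : List (Fin n × Fin n) → List ℕ
  edgeCodes = map edgeCode

-- Listed in increasing order, so that it is what sorting the edge codes of a design yields.
completeEdgeCodes : (n : ℕ) → List ℕ
completeEdgeCodes n = map pairCode (filter (uncurry _<?_) (cartesianProduct (allFin n) (allFin n)))

completeEdgeCodes-unique : ∀ n → Unique (completeEdgeCodes n)
completeEdgeCodes-unique n = Unique.map⁺ pairCode-injective
  (Unique.filter⁺ (uncurry _<?_) (Unique.cartesianProduct⁺ (Unique.allFin⁺ n) (Unique.allFin⁺ n)))

edgeCode∈completeEdgeCodes : ∀ {n} {x y : Fin n} → x ≢ y → edgeCode (x , y) ∈ completeEdgeCodes n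
edgeCode∈completeEdgeCodes x≢y =
  ∈-map⁺ pairCode (∈-filter⁺ (uncurry _<?_) (∈-cartesianProduct⁺ (∈-allFin _) (∈-allFin _)) (orient-< x≢y))

copyEdges : (G : Graph) {n : ℕ} → List (Fin (order G) → Fin n) → List (Fin n × Fin n)
copyEdges G = concatMap (imageEdges G)

isDesign-bySortedCodes : (G : Graph) (n : ℕ) (copies : List (Fin (order G) → Fin n)) →
                         All (Injective _≡_ _≡_) copies →
                         sort (edgeCodes (copyEdges G copies)) ≡ completeEdgeCodes n →
                         IsDesign G n copies
isDesign-bySortedCodes G n copies injective sorted = injective , λ x y x≢y →
  let k = edgeCode (x , y); E = copyEdges G copies in begin
  length (filter (sameEdge? (x , y)) E)         ≡⟨ length-filter-map (sameEdge? (x , y)) (k ≟_) edgeCode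
                                                     (SameEdge⇒edgeCode≡ , edgeCode≡⇒SameEdge) E ⟩
  length (filter (k ≟_) (edgeCodes E))          ≡⟨ ↭-length (filter-↭ (k ≟_) (↭-sym (sort-↭ (edgeCodes E)))) ⟩
  length (filter (k ≟_) (sort (edgeCodes E)))   ≡⟨ cong (length ∘ filter (k ≟_)) sorted ⟩
  length (filter (k ≟_) (completeEdgeCodes n))  ≡⟨ unique∧∈⇒length-filter-≟≡1 (completeEdgeCodes-unique n)
                                                     (edgeCode∈completeEdgeCodes x≢y) ⟩
  1                                             ∎
  where open ≡-Reasoning

%-translate-injective : ∀ n .{{_ : NonZero n}} t {a b} → (a + t) % n ≡ (b + t) % n → a % n ≡ b % n
%-translate-injective n@(suc m) t {a} {b} eq =
  trans (untranslate a) (trans (cong (λ r → (r + m * t % n) % n) eq) (sym (untranslate b)))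
  where
  open ≡-Reasoning
  -- Since t + m t = n t, adding m t undoes the translation by t.
  untranslate : ∀ c → c % n ≡ ((c + t) % n + m * t % n) % n
  untranslate c = begin
    c % n                           ≡⟨ [m+kn]%n≡m%n c t n ⟨
    (c + t * n) % n                 ≡⟨ cong (λ r → (c + r) % n) (ℕ.*-suc t m) ⟩
    (c + (t + t * m)) % n           ≡⟨ cong (_% n) (+-assoc c t (t * m)) ⟨
    (c + t + t * m) % n             ≡⟨ cong (λ r → (c + t + r) % n) (*-comm t m) ⟩
    (c + t + m * t) % n             ≡⟨ %-distribˡ-+ (c + t) (m * t) n ⟩
    ((c + t) % n + m * t % n) % n   ∎

mod≡⇒%≡ : ∀ {a b n} .{{_ : NonZero n}} → a mod n ≡ b mod n → a % n ≡ b % n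
mod≡⇒%≡ eq = trans (sym (toℕ-fromℕ< _)) (trans (cong toℕ eq) (toℕ-fromℕ< _))

translate : (n : ℕ) .{{_ : NonZero n}} → ℕ → {A : Set} → (A → ℕ) → A → Fin n
translate n t f a = (f a + t) mod n

translate-injective : ∀ n .{{_ : NonZero n}} t {A : Set} (f : A → ℕ) →
                      Injective _≡_ _≡_ (λ a → f a % n) → Injective _≡_ _≡_ (translate n t f)
translate-injective n t f f-injective eq = f-injective (%-translate-injective n t (mod≡⇒%≡ eq))

orbit : (n : ℕ) .{{_ : NonZero n}} {k : ℕ} → List ℕ → Vec ℕ k → List (Fin k → Fin n)
orbit n shifts B = map (λ t → translate n t (lookup B)) shifts

orbit-injective : ∀ n .{{_ : NonZero n}} {k} shifts (B : Vec ℕ k) →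
                  Injective _≡_ _≡_ (λ i → lookup B i % n) → All (Injective _≡_ _≡_) (orbit n shifts B)
orbit-injective n shifts B B-injective =
  map⁺ (All.universal (λ t {i} {j} → translate-injective n t (lookup B) B-injective) shifts)

development : (n : ℕ) .{{_ : NonZero n}} {k : ℕ} → List ℕ → List (Vec ℕ k) → List (Fin k → Fin n)
development n shifts = concatMap (orbit n shifts)

development-injective : ∀ n .{{_ : NonZero n}} {k} shifts (bases : List (Vec ℕ k)) →
                        All (λ B → Injective _≡_ _≡_ (λ i → lookup B i % n)) bases →
                        All (Injective _≡_ _≡_) (development n shifts bases)
development-injective n shifts bases injective =
  concat⁺ (map⁺ (All.map (λ {B} → orbit-injective n shifts B) injective))

injective? : ∀ {k} {B : Set} → DecidableEquality B → (f : Fin k → B) → Dec (Injective _≡_ _≡_ f)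
injective? _≟ᴮ_ f = map′ (λ inj {i} {j} → inj i j) (λ inj i j → inj)
  (all? λ i → all? λ j → (f i ≟ᴮ f j) →-dec (i ≟ᶠ j))

developmentDesign : (G : Graph) (n : ℕ) .{{_ : NonZero n}} (shifts : List ℕ) (bases : List (Vec ℕ (order G))) →
  True (All.all? (λ B → injective? _≟_ (λ i → lookup B i % n)) bases) →
  True (≡-dec _≟_ (sort (edgeCodes (copyEdges G (development n shifts bases)))) (completeEdgeCodes n)) →
  HasDesign G n
developmentDesign G n shifts bases injective sorted = development n shifts bases ,
  isDesign-bySortedCodes G n _ (development-injective n shifts bases (toWitness injective)) (toWitness sorted)

-- The vertex 4 x + l of ℤ_28 stands for the point (x , l) of ℤ_7 × ℤ_4, on which ℤ_7 acts
-- by translation in the first coordinate; accordingly these blocks are shifted by multiples of 4.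
baseBlocks-B11-28 baseBlocks-B12-28 : List (Vec ℕ 18)
baseBlocks-B11-28 =
    (0 ∷ 26 ∷ 1 ∷ 4 ∷ 19 ∷ 21 ∷ 12 ∷ 5 ∷ 25 ∷ 11 ∷ 10 ∷ 7 ∷ 20 ∷ 14 ∷ 13 ∷ 16 ∷ 8 ∷ 23 ∷ [])
  ∷ (17 ∷ 26 ∷ 14 ∷ 3 ∷ 22 ∷ 19 ∷ 7 ∷ 15 ∷ 20 ∷ 5 ∷ 4 ∷ 18 ∷ 6 ∷ 8 ∷ 21 ∷ 2 ∷ 9 ∷ 27 ∷ [])
  ∷ []
baseBlocks-B12-28 =
    (0 ∷ 16 ∷ 25 ∷ 23 ∷ 24 ∷ 7 ∷ 1 ∷ 26 ∷ 9 ∷ 2 ∷ 13 ∷ 6 ∷ 21 ∷ 18 ∷ 4 ∷ 15 ∷ 10 ∷ 27 ∷ [])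
  ∷ (23 ∷ 21 ∷ 22 ∷ 17 ∷ 15 ∷ 11 ∷ 0 ∷ 26 ∷ 1 ∷ 19 ∷ 20 ∷ 4 ∷ 7 ∷ 6 ∷ 2 ∷ 16 ∷ 5 ∷ 8 ∷ [])
  ∷ []

baseBlocks-B11-55 baseBlocks-B12-55 : List (Vec ℕ 18)
baseBlocks-B11-55 =
    (0 ∷ 7 ∷ 32 ∷ 9 ∷ 26 ∷ 41 ∷ 25 ∷ 54 ∷ 39 ∷ 5 ∷ 43 ∷ 44 ∷ 53 ∷ 27 ∷ 51 ∷ 10 ∷ 38 ∷ 46 ∷ [])
  ∷ []
baseBlocks-B12-55 =
    (0 ∷ 7 ∷ 32 ∷ 9 ∷ 26 ∷ 35 ∷ 54 ∷ 5 ∷ 49 ∷ 38 ∷ 51 ∷ 31 ∷ 30 ∷ 3 ∷ 42 ∷ 13 ∷ 23 ∷ 46 ∷ [])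
  ∷ []

baseBlocks-B11-109 baseBlocks-B12-109 : List (Vec ℕ 18)
baseBlocks-B11-109 =
    (0 ∷ 96 ∷ 5 ∷ 38 ∷ 106 ∷ 76 ∷ 15 ∷ 26 ∷ 70 ∷ 22 ∷ 58 ∷ 3 ∷ 49 ∷ 91 ∷ 92 ∷ 54 ∷ 77 ∷ 1 ∷ [])
  ∷ (2 ∷ 12 ∷ 105 ∷ 81 ∷ 70 ∷ 59 ∷ 28 ∷ 21 ∷ 101 ∷ 107 ∷ 62 ∷ 104 ∷ 77 ∷ 102 ∷ 45 ∷ 34 ∷ 40 ∷ 56 ∷ [])
  ∷ []
baseBlocks-B12-109 =
    (0 ∷ 96 ∷ 5 ∷ 38 ∷ 106 ∷ 15 ∷ 26 ∷ 22 ∷ 86 ∷ 77 ∷ 33 ∷ 3 ∷ 49 ∷ 1 ∷ 37 ∷ 9 ∷ 76 ∷ 90 ∷ [])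
  ∷ (2 ∷ 22 ∷ 105 ∷ 100 ∷ 86 ∷ 28 ∷ 71 ∷ 66 ∷ 101 ∷ 80 ∷ 98 ∷ 19 ∷ 43 ∷ 36 ∷ 51 ∷ 29 ∷ 59 ∷ 103 ∷ [])
  ∷ []

lemma3 : (G : Graph) → (G ≡ B11 ⊎ G ≡ B12) → (n : ℕ) → (n ≡ 28 ⊎ n ≡ 55 ⊎ n ≡ 109) → HasDesign G n
lemma3 _ (inj₁ refl) _ (inj₁ refl)        = developmentDesign B11 28 (map (4 *_) (upTo 7)) baseBlocks-B11-28 tt tt
lemma3 _ (inj₁ refl) _ (inj₂ (inj₁ refl)) = developmentDesign B11 55 (upTo 55) baseBlocks-B11-55 tt tt
lemma3 _ (inj₁ refl) _ (inj₂ (inj₂ refl)) = developmentDesign B11 109 (upTo 109) baseBlocks-B11-109 tt tt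
lemma3 _ (inj₂ refl) _ (inj₁ refl)        = developmentDesign B12 28 (map (4 *_) (upTo 7)) baseBlocks-B12-28 tt tt
lemma3 _ (inj₂ refl) _ (inj₂ (inj₁ refl)) = developmentDesign B12 55 (upTo 55) baseBlocks-B12-55 tt tt
lemma3 _ (inj₂ refl) _ (inj₂ (inj₂ refl)) = developmentDesign B12 109 (upTo 109) baseBlocks-B12-109 tt tt
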